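{- Let $i\geq 1$ and $n_1,\ldots,n_i\geq 1$ be positive integers, and let $j$ be a positive integer with $j\leq 6$. Then \[m_j(C_3, C_3, n_1K_2,n_2K_2,\ldots,n_iK_2)=\begin{cases}\infty & \text{if } j\leq 5,\\ 1+\sum_{\ell=1}^{i}(n_\ell-1) & \text{if } j=6.\end{cases}\]
   Context: $K_{j\times t}$ denotes the complete multipartite graph with $j$ partite sets, each of size $t$. For graphs $H_1,\ldots,H_k$, the multipartite Ramsey number $m_j(H_1,\ldots,H_k)$ is the smallest positive integer $t$ such that for every $k$-edge-coloring $(G^1,\ldots,G^k)$ of $K_{j\times t}$ (i.e. every partition of its edge set into spanning subgraphs $G^1,\ldots,G^k$), there is some $\ell$ with $G^\ell$ containing a copy of $H_\ell$; it is $\infty$ if no such $t$ exists. $C_m$ is the cycle on $m$ vertices and $nK_2$ is a matching of $n$ edges (n pairwise disjoint edges). -}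

module Defs where

open import Level using (0ℓ)
open import Data.Nat using (ℕ; zero; suc; _+_; _∸_; _≤_; _<_)
open import Data.Fin using (Fin; zero; suc)
open import Data.Vec using (Vec; lookup; map; sum)
open import Data.Product using (_×_; _,_; Σ; ∃)
open import Relation.Binary.PropositionalEquality using (_≡_; _≢_)
open import Relation.Nullary using (¬_)
open import Function.Definitions using (Injective)

record Graph : Set₁ where
  field
    V   : Set
    Adj : V → V → Set

C₃ : Graph
C₃ = record { V = Fin 3 ; Adj = λ a b → a ≢ b }

matching : ℕ → Graph
matching n = record
  { V = Fin n × Fin 2
  ; Adj = λ { (a , x) (b , y) → a ≡ b × x ≢ y } }

-- Vertices of the complete multipartite graph K_{j×t}: (part, index in part).
KV : ℕ → ℕ → Set
KV j t = Fin j × Fin t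

part : ∀ {j t} → KV j t → Fin j
part (p , _) = p

KAdj : ∀ {j t} → KV j t → KV j t → Set
KAdj u v = part u ≢ part v

-- A k-edge-colouring of K_{j×t}: each edge {u,v} gets a colour in Fin k
-- (symmetric, so it is a colouring of unordered edges; values on
-- non-edges are irrelevant).
record Colouring (k j t : ℕ) : Set where
  field
    colour : KV j t → KV j t → Fin k
    sym    : ∀ u v → colour u v ≡ colour v u
open Colouring public

ContainsCopy : ∀ {k j t} → Colouring k j t → Fin k → Graph → Set
ContainsCopy {k} {j} {t} c ℓ H =
  Σ (Graph.V H → KV j t) λ f →
    Injective _≡_ _≡_ f ×
    (∀ u v → Graph.Adj H u v → KAdj (f u) (f v) × colour c (f u) (f v) ≡ ℓ)

Arrows : ∀ {k} → (j t : ℕ) → (Fin k → Graph) → Set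
Arrows {k} j t Hs = (c : Colouring k j t) → ∃ λ ℓ → ContainsCopy c ℓ (Hs ℓ)

data ℕ∞ : Set where
  fin : ℕ → ℕ∞
  ∞   : ℕ∞

MultipartiteRamsey : ∀ {k} → ℕ → (Fin k → Graph) → ℕ∞ → Set
MultipartiteRamsey j Hs (fin r) =
  1 ≤ r × Arrows j r Hs × (∀ t → 1 ≤ t → t < r → ¬ Arrows j t Hs)
MultipartiteRamsey j Hs ∞ = ∀ t → 1 ≤ t → ¬ Arrows j t Hs

triTriMatchings : ∀ {i} → Vec ℕ i → Fin (2 + i) → Graph
triTriMatchings ns zero = C₃
triTriMatchings ns (suc zero) = C₃
triTriMatchings ns (suc (suc ℓ)) = matching (lookup ns ℓ)

matchingBound : ∀ {i} → Vec ℕ i → ℕ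
matchingBound ns = suc (sum (map (λ n → n ∸ 1) ns))

-- Colours 0 and 1 are the triangle colours, colour 2 + ℓ the ℓ-th matching colour.
-- For j ≤ 5, colouring the edges between the parts of K_{j×t} like the edges of a
-- 2-coloured pentagon with no monochromatic triangle avoids every triangle, and never
-- uses a matching colour.  For j = 6 and t = Σ (n_ℓ − 1), split the sixth part into
-- blocks of sizes n_ℓ − 1 and give every edge at a vertex of block ℓ the colour
-- 2 + ℓ: that colour class is then covered by n_ℓ − 1 vertices, so it contains no
-- n_ℓ K₂.  Conversely, for t = 1 + Σ (n_ℓ − 1) grow matchings greedily: as long as
-- each has fewer than n_ℓ edges, they use at most Σ (n_ℓ − 1) < t vertices of every
-- part (an edge meets each part at most once), so some six vertices, one per part,
-- are untouched.  Either an edge between them has a matching colour and extends that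
-- matching, or they span a 2-coloured K₆, which has a monochromatic triangle by
-- R(3,3) = 6.
module Submission where

open import Defs hiding (sym)
open import Data.Nat using (ℕ; zero; suc; _+_; _∸_; _≤_; _<_; _<?_; z≤n; s≤s; ∣_-_∣)
open import Data.Nat.Properties
  using (+-mono-≤; +-suc; +-identityʳ; ≤-refl; ≤-pred; ≤-reflexive; ≤-antisym; ≤-<-trans; m≤n+m;
         ≮⇒≥; n<1+n; <-irrefl; ∣-∣-comm; module ≤-Reasoning)
open import Data.Fin as Fin using (Fin; zero; suc; toℕ; inject≤; _↑ˡ_; _↑ʳ_; splitAt; fromℕ)
open import Data.Fin.Properties
  using (_≟_; any?; all?; suc-injective; <⇒≢; <-trans; inject≤-injective; ↑ˡ-injective;
         <⇒notInjective; ¬∀⟶∃¬; splitAt-↑ˡ; splitAt-↑ʳ; splitAt⁻¹-↑ˡ; splitAt⁻¹-↑ʳ; join-splitAt)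
open import Data.Vec using (Vec; []; _∷_; sum; tabulate; lookup; map)
open import Data.Vec.Properties using (tabulate-cong; tabulate∘lookup; tabulate-∘; lookup∘tabulate)
open import Data.Vec.Relation.Unary.All using (All)
open import Data.Vec.Relation.Unary.All.Properties using (lookup⁺)
import Data.Product as Prod
open import Data.Product using (Σ; ∃; _×_; _,_; proj₁; proj₂)
open import Data.Product.Properties using (≡-dec; ,-injective; ,-injectiveʳ)
open import Data.Sum using (_⊎_; inj₁; inj₂; [_,_]′)
open import Function using (_∘_; id; const)
open import Function.Definitions using (Injective)
open import Relation.Binary using (Decidable)
open import Relation.Nullary using (¬_; Dec; yes; no; ¬?; contradiction)
open import Relation.Nullary.Decidable using (_×-dec_; from-yes; from-no)
open import Relation.Binary.PropositionalEquality

∑ : ∀ {i} → (Fin i → ℕ) → ℕ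
∑ f = sum (tabulate f)

∑-mono-≤ : ∀ {i} {f g : Fin i → ℕ} → (∀ ℓ → f ℓ ≤ g ℓ) → ∑ f ≤ ∑ g
∑-mono-≤ {zero} f≤g = ≤-refl
∑-mono-≤ {suc i} f≤g = +-mono-≤ (f≤g zero) (∑-mono-≤ (f≤g ∘ suc))

∑-cong : ∀ {i} {f g : Fin i → ℕ} → (∀ ℓ → f ℓ ≡ g ℓ) → ∑ f ≡ ∑ g
∑-cong f≗g = cong sum (tabulate-cong f≗g)

∑-suc-at : ∀ {i} {f g : Fin i → ℕ} ℓ → g ℓ ≡ suc (f ℓ) → (∀ ℓ′ → ℓ′ ≢ ℓ → g ℓ′ ≡ f ℓ′) → ∑ g ≡ suc (∑ f)
∑-suc-at zero gℓ others = cong₂ _+_ gℓ (∑-cong λ ℓ′ → others (suc ℓ′) λ ())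
∑-suc-at {f = f} {g} (suc ℓ) gℓ others = begin
  g zero + ∑ (g ∘ suc)         ≡⟨ cong₂ _+_ (others zero λ ())
                                    (∑-suc-at ℓ gℓ λ ℓ′ ℓ′≢ℓ → others (suc ℓ′) (ℓ′≢ℓ ∘ suc-injective)) ⟩
  f zero + suc (∑ (f ∘ suc))   ≡⟨ +-suc (f zero) _ ⟩
  suc (∑ f)                    ∎
  where open ≡-Reasoning

sum-map : ∀ {A : Set} {i} (h : A → ℕ) (xs : Vec A i) → sum (map h xs) ≡ ∑ (h ∘ lookup xs)
sum-map h xs = cong sum (begin
  map h xs                       ≡⟨ cong (map h) (tabulate∘lookup xs) ⟨
  map h (tabulate (lookup xs))   ≡⟨ tabulate-∘ h (lookup xs) ⟨
  tabulate (h ∘ lookup xs)       ∎)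
  where open ≡-Reasoning

splitAt-injective : ∀ m {n} {p q : Fin (m + n)} → splitAt m p ≡ splitAt m q → p ≡ q
splitAt-injective m {n} {p} {q} eq = begin
  p                            ≡⟨ join-splitAt m n p ⟨
  Fin.join m n (splitAt m p)   ≡⟨ cong (Fin.join m n) eq ⟩
  Fin.join m n (splitAt m q)   ≡⟨ join-splitAt m n q ⟩
  q                            ∎
  where open ≡-Reasoning

combineΣ : ∀ {i} (f : Fin i → ℕ) → Σ (Fin i) (Fin ∘ f) → Fin (∑ f)
combineΣ f (zero , x) = x ↑ˡ ∑ (f ∘ suc)
combineΣ f (suc ℓ , x) = f zero ↑ʳ combineΣ (f ∘ suc) (ℓ , x)

splitΣ : ∀ {i} (f : Fin i → ℕ) → Fin (∑ f) → Σ (Fin i) (Fin ∘ f)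
splitΣ {suc i} f a with splitAt (f zero) a
... | inj₁ x = zero , x
... | inj₂ b = Prod.map suc id (splitΣ (f ∘ suc) b)

splitΣ-combineΣ : ∀ {i} (f : Fin i → ℕ) p → splitΣ f (combineΣ f p) ≡ p
splitΣ-combineΣ f (zero , x) rewrite splitAt-↑ˡ (f zero) x (∑ (f ∘ suc)) = refl
splitΣ-combineΣ f (suc ℓ , x)
  rewrite splitAt-↑ʳ (f zero) (∑ (f ∘ suc)) (combineΣ (f ∘ suc) (ℓ , x))
        | splitΣ-combineΣ (f ∘ suc) (ℓ , x) = refl

combineΣ-splitΣ : ∀ {i} (f : Fin i → ℕ) a → combineΣ f (splitΣ f a) ≡ a
combineΣ-splitΣ {suc i} f a with splitAt (f zero) a in eq
... | inj₁ x = splitAt⁻¹-↑ˡ eq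
... | inj₂ b = trans (cong (f zero ↑ʳ_) (combineΣ-splitΣ (f ∘ suc) b)) (splitAt⁻¹-↑ʳ eq)

combineΣ-injective : ∀ {i} (f : Fin i → ℕ) {p q} → combineΣ f p ≡ combineΣ f q → p ≡ q
combineΣ-injective f {p} {q} eq = begin
  p                         ≡⟨ splitΣ-combineΣ f p ⟨
  splitΣ f (combineΣ f p)   ≡⟨ cong (splitΣ f) eq ⟩
  splitΣ f (combineΣ f q)   ≡⟨ splitΣ-combineΣ f q ⟩
  q                         ∎
  where open ≡-Reasoning

-- Triangles in 2-coloured complete graphs

Triangle : {W : Set} → (W → W → Set) → Set
Triangle E = ∃ λ a → ∃ λ b → ∃ λ d → E a b × E a d × E b d

triangle? : ∀ {n} {E : Fin n → Fin n → Set} → Decidable E → Dec (Triangle E)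
triangle? E? = any? λ a → any? λ b → any? λ d → E? a b ×-dec E? a d ×-dec E? b d

ColourClass : {W : Set} → (W → W → Fin 2) → Fin 2 → W → W → Set
ColourClass κ col a b = a ≢ b × κ a b ≡ col

colourClass? : ∀ {n} (κ : Fin n → Fin n → Fin 2) col → Decidable (ColourClass κ col)
colourClass? κ col a b = ¬? (a ≟ b) ×-dec (κ a b ≟ col)

-- Colour 0 on the sides of the pentagon 0-1-2-3-4, colour 1 on its diagonals.
pentagonDistanceColour : ℕ → Fin 2
pentagonDistanceColour 1 = zero
pentagonDistanceColour 4 = zero
pentagonDistanceColour _ = suc zero

pentagon : Fin 5 → Fin 5 → Fin 2
pentagon a b = pentagonDistanceColour ∣ toℕ a - toℕ b ∣

pentagon-sym : ∀ a b → pentagon a b ≡ pentagon b a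
pentagon-sym a b = cong pentagonDistanceColour (∣-∣-comm (toℕ a) (toℕ b))

pentagon-triangleFree : ∀ col → ¬ Triangle (ColourClass pentagon col)
pentagon-triangleFree zero = from-no (triangle? (colourClass? pentagon zero))
pentagon-triangleFree (suc zero) = from-no (triangle? (colourClass? pentagon (suc zero)))

MonochromaticTriple : (Fin 5 → Fin 2) → Set
MonochromaticTriple f = ∃ λ a → ∃ λ b → ∃ λ d → a Fin.< b × b Fin.< d × f a ≡ f b × f a ≡ f d

monochromaticTriple? : ∀ f → Dec (MonochromaticTriple f)
monochromaticTriple? f = any? λ a → any? λ b → any? λ d →
  toℕ a <? toℕ b ×-dec toℕ b <? toℕ d ×-dec f a ≟ f b ×-dec f a ≟ f d

allColourings : ∀ x₀ x₁ x₂ x₃ x₄ → MonochromaticTriple (lookup (x₀ ∷ x₁ ∷ x₂ ∷ x₃ ∷ x₄ ∷ []))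
allColourings = from-yes (all? λ x₀ → all? λ x₁ → all? λ x₂ → all? λ x₃ → all? λ x₄ →
  monochromaticTriple? (lookup (x₀ ∷ x₁ ∷ x₂ ∷ x₃ ∷ x₄ ∷ [])))

MonochromaticTriple-cong : ∀ {f g} → (∀ a → f a ≡ g a) → MonochromaticTriple f → MonochromaticTriple g
MonochromaticTriple-cong {f} {g} f≗g (a , b , d , a<b , b<d , fa≡fb , fa≡fd) =
  a , b , d , a<b , b<d , transport fa≡fb , transport fa≡fd
  where
  transport : ∀ {a b} → f a ≡ f b → g a ≡ g b
  transport {a} {b} eq = trans (sym (f≗g a)) (trans eq (f≗g b))

-- Opaque, so that unifying with its projections never unfolds the exhaustive check.
opaque
  monochromaticTriple : ∀ f → MonochromaticTriple f
  monochromaticTriple f = MonochromaticTriple-cong (lookup∘tabulate f)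
    (allColourings (f zero) (f (suc zero)) (f (suc (suc zero))) (f (suc (suc (suc zero))))
                   (f (suc (suc (suc (suc zero))))))

≢-Fin2 : ∀ {x y z : Fin 2} → x ≢ z → y ≢ z → x ≡ y
≢-Fin2 {zero} {zero} _ _ = refl
≢-Fin2 {suc zero} {suc zero} _ _ = refl
≢-Fin2 {zero} {suc zero} {zero} x≢z _ = contradiction refl x≢z
≢-Fin2 {zero} {suc zero} {suc zero} _ y≢z = contradiction refl y≢z
≢-Fin2 {suc zero} {zero} {zero} _ y≢z = contradiction refl y≢z
≢-Fin2 {suc zero} {zero} {suc zero} x≢z _ = contradiction refl x≢z

-- Either an edge among a, b, d has colour col, or all three have the other colour.
fan⇒triangle : ∀ {n} (κ : Fin n → Fin n → Fin 2) {col o a b d} →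
  ColourClass κ col o a → ColourClass κ col o b → ColourClass κ col o d →
  a ≢ b → a ≢ d → b ≢ d → ∃ λ col′ → Triangle (ColourClass κ col′)
fan⇒triangle κ {col} {o} {a} {b} {d} oa ob od a≢b a≢d b≢d
  with κ a b ≟ col | κ a d ≟ col | κ b d ≟ col
... | yes ab | _ | _ = col , o , a , b , oa , ob , (a≢b , ab)
... | no _ | yes ad | _ = col , o , a , d , oa , od , (a≢d , ad)
... | no _ | no _ | yes bd = col , o , b , d , ob , od , (b≢d , bd)
... | no ¬ab | no ¬ad | no ¬bd =
  κ a b , a , b , d , (a≢b , refl) , (a≢d , ≢-Fin2 ¬ad ¬ab) , (b≢d , ≢-Fin2 ¬bd ¬ab)

-- The colouring need not be symmetric.
ramsey33 : (κ : Fin 6 → Fin 6 → Fin 2) → ∃ λ col → Triangle (ColourClass κ col)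
ramsey33 κ =
  let (a , b , d , a<b , b<d , κa≡κb , κa≡κd) = monochromaticTriple (κ zero ∘ suc) in
  fan⇒triangle κ ((λ ()) , refl) ((λ ()) , sym κa≡κb) ((λ ()) , sym κa≡κd)
    (<⇒≢ a<b ∘ suc-injective) (<⇒≢ (<-trans a<b b<d) ∘ suc-injective) (<⇒≢ b<d ∘ suc-injective)

Avoids : ∀ {A : Set} {j t} → (A → KV j t) → KV j t → Set
Avoids f v = ∀ z → f z ≢ v

module _ {k j t} (c : Colouring k j t) where

  Edge : Fin k → KV j t → KV j t → Set
  Edge ℓ u v = KAdj u v × colour c u v ≡ ℓ

  Edge-sym : ∀ {ℓ u v} → Edge ℓ u v → Edge ℓ v u
  Edge-sym {u = u} {v} (u≁v , colour≡) = u≁v ∘ sym , trans (Colouring.sym c v u) colour≡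

  Edge-≢ : ∀ {ℓ u v} → Edge ℓ u v → u ≢ v
  Edge-≢ (u≁v , _) u≡v = u≁v (cong part u≡v)

  triangle⇒copy : ∀ {ℓ} {W : Set} {E : W → W → Set} (x : W → KV j t) →
    (∀ {a b} → E a b → Edge ℓ (x a) (x b)) → Triangle E → ContainsCopy c ℓ C₃
  triangle⇒copy {ℓ} x edge (a , b , d , ab , ad , bd) = f , f-injective , f-edge
    where
    f : Fin 3 → KV j t
    f zero = x a
    f (suc zero) = x b
    f (suc (suc zero)) = x d
    f-edge : ∀ u v → u ≢ v → Edge ℓ (f u) (f v)
    f-edge zero zero u≢v = contradiction refl u≢v
    f-edge zero (suc zero) _ = edge ab
    f-edge zero (suc (suc zero)) _ = edge ad
    f-edge (suc zero) zero _ = Edge-sym (edge ab)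
    f-edge (suc zero) (suc zero) u≢v = contradiction refl u≢v
    f-edge (suc zero) (suc (suc zero)) _ = edge bd
    f-edge (suc (suc zero)) zero _ = Edge-sym (edge ad)
    f-edge (suc (suc zero)) (suc zero) _ = Edge-sym (edge bd)
    f-edge (suc (suc zero)) (suc (suc zero)) u≢v = contradiction refl u≢v
    -- C₃ is complete, so an edge-preserving map cannot identify two vertices.
    f-injective : Injective _≡_ _≡_ f
    f-injective {u} {v} fu≡fv with u ≟ v
    ... | yes u≡v = u≡v
    ... | no u≢v = contradiction fu≡fv (Edge-≢ (f-edge u v u≢v))

  triangleFree⇒noCopy : ∀ {ℓ} {W : Set} {E : W → W → Set} (φ : KV j t → W) →
    (∀ {u v} → Edge ℓ u v → E (φ u) (φ v)) → ¬ Triangle E → ¬ ContainsCopy c ℓ C₃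
  triangleFree⇒noCopy φ edge noTriangle (f , _ , f-edge) = noTriangle
    (φ (f zero) , φ (f (suc zero)) , φ (f (suc (suc zero))) ,
     edge (f-edge _ _ λ ()) , edge (f-edge _ _ λ ()) , edge (f-edge _ _ λ ()))

  Cover : Fin k → ℕ → Set
  Cover ℓ m = Σ (Fin m → KV j t) λ cover →
    ∀ {u v} → Edge ℓ u v → ∃ λ x → cover x ≡ u ⊎ cover x ≡ v

  cover⇒noMatching : ∀ {ℓ m n} → m < n → Cover ℓ m → ¬ ContainsCopy c ℓ (matching n)
  cover⇒noMatching {m = m} {n} m<n (cover , covers) (f , f-injective , f-edge) =
    <⇒notInjective m<n g-injective
    where
    coverOf : (e : Fin n) → ∃ λ x → ∃ λ s → cover x ≡ f (e , s)
    coverOf e with covers (f-edge (e , zero) (e , suc zero) (refl , λ ()))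
    ... | x , inj₁ eq = x , zero , eq
    ... | x , inj₂ eq = x , suc zero , eq
    g : Fin n → Fin m
    g = proj₁ ∘ coverOf
    g-injective : Injective _≡_ _≡_ g
    g-injective {e} {e′} ge≡ge′ =
      let (_ , s , eq) = coverOf e ; (_ , s′ , eq′) = coverOf e′ in
      cong proj₁ (f-injective (begin
        f (e , s)      ≡⟨ sym eq ⟩
        cover (g e)    ≡⟨ cong cover ge≡ge′ ⟩
        cover (g e′)   ≡⟨ eq′ ⟩
        f (e′ , s′)    ∎))
      where open ≡-Reasoning

  emptyMatching : ∀ {ℓ} → ContainsCopy c ℓ (matching 0)
  emptyMatching = (λ ()) , (λ { {() , _} }) , λ { (() , _) }

  extendMatching : ∀ {ℓ m u v} (M : ContainsCopy c ℓ (matching m)) → Edge ℓ u v →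
    Avoids (proj₁ M) u → Avoids (proj₁ M) v → ContainsCopy c ℓ (matching (suc m))
  extendMatching {ℓ} {m} {u} {v} (f , f-injective , f-edge) uv u-free v-free =
    f′ , f′-injective , f′-edge
    where
    f′ : Fin (suc m) × Fin 2 → KV j t
    f′ (zero , zero) = u
    f′ (zero , suc zero) = v
    f′ (suc e , s) = f (e , s)
    f′-injective : Injective _≡_ _≡_ f′
    f′-injective {zero , zero} {zero , zero} _ = refl
    f′-injective {zero , suc zero} {zero , suc zero} _ = refl
    f′-injective {zero , zero} {zero , suc zero} u≡v = contradiction u≡v (Edge-≢ uv)
    f′-injective {zero , suc zero} {zero , zero} v≡u = contradiction (sym v≡u) (Edge-≢ uv)
    f′-injective {zero , zero} {suc e , s} u≡f = contradiction (sym u≡f) (u-free (e , s))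
    f′-injective {zero , suc zero} {suc e , s} v≡f = contradiction (sym v≡f) (v-free (e , s))
    f′-injective {suc e , s} {zero , zero} f≡u = contradiction f≡u (u-free (e , s))
    f′-injective {suc e , s} {zero , suc zero} f≡v = contradiction f≡v (v-free (e , s))
    f′-injective {suc e , s} {suc e′ , s′} f≡f = cong (Prod.map₁ suc) (f-injective f≡f)
    f′-edge : ∀ a b → Graph.Adj (matching (suc m)) a b → Edge ℓ (f′ a) (f′ b)
    f′-edge (zero , zero) (zero , zero) (_ , s≢s) = contradiction refl s≢s
    f′-edge (zero , zero) (zero , suc zero) _ = uv
    f′-edge (zero , suc zero) (zero , zero) _ = Edge-sym uv
    f′-edge (zero , suc zero) (zero , suc zero) (_ , s≢s) = contradiction refl s≢s
    f′-edge (suc e , s) (suc e′ , s′) (e≡e′ , s≢s′) = f-edge (e , s) (e′ , s′) (suc-injective e≡e′ , s≢s′)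

freeVertex : ∀ {i j t} (size : Fin i → ℕ) (M : ∀ ℓ → Fin (size ℓ) × Fin 2 → KV j t) →
  (∀ ℓ e → KAdj (M ℓ (e , zero)) (M ℓ (e , suc zero))) → ∑ size < t →
  ∀ p → ∃ λ a → ∀ ℓ → Avoids (M ℓ) (p , a)
freeVertex {t = t} size M crossing ∑<t p = Prod.map₂ avoids (¬∀⟶∃¬ t Used used? notAllUsed)
  where
  Used : Fin t → Set
  Used a = ∃ λ ℓ → ∃ λ e → ∃ λ s → M ℓ (e , s) ≡ (p , a)
  used? : ∀ a → Dec (Used a)
  used? a = any? λ ℓ → any? λ e → any? λ s → ≡-dec _≟_ _≟_ (M ℓ (e , s)) (p , a)
  avoids : ∀ {a} → ¬ Used a → ∀ ℓ → Avoids (M ℓ) (p , a)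
  avoids unused ℓ (e , s) eq = unused (ℓ , e , s , eq)
  onePerPart : ∀ ℓ e s s′ → part (M ℓ (e , s)) ≡ part (M ℓ (e , s′)) → s ≡ s′
  onePerPart ℓ e zero zero _ = refl
  onePerPart ℓ e zero (suc zero) eq = contradiction eq (crossing ℓ e)
  onePerPart ℓ e (suc zero) zero eq = contradiction (sym eq) (crossing ℓ e)
  onePerPart ℓ e (suc zero) (suc zero) _ = refl
  sameEdge : ∀ {ℓ ℓ′ e e′ s s′ a a′} → (ℓ , e) ≡ (ℓ′ , e′) →
    M ℓ (e , s) ≡ (p , a) → M ℓ′ (e′ , s′) ≡ (p , a′) → a ≡ a′
  sameEdge {ℓ} {e = e} {s = s} {s′} refl eq eq′
    with refl ← onePerPart ℓ e s s′ (trans (cong part eq) (sym (cong part eq′)))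
    = ,-injectiveʳ (trans (sym eq) eq′)
  edgeOf : ∀ {a} → Used a → Fin (∑ size)
  edgeOf (ℓ , e , _) = combineΣ size (ℓ , e)
  notAllUsed : ¬ (∀ a → Used a)
  notAllUsed used = <⇒notInjective ∑<t edgeOf-injective
    where
    edgeOf-injective : Injective _≡_ _≡_ (edgeOf ∘ used)
    edgeOf-injective {a} {a′} eq =
      let (_ , _ , _ , at) = used a ; (_ , _ , _ , at′) = used a′ in
      sameEdge (combineΣ-injective size eq) at at′

module _ {j j′ t t′ : ℕ} (j≤j′ : j ≤ j′) (t≤t′ : t ≤ t′) where

  embedKV : KV j t → KV j′ t′
  embedKV (p , a) = inject≤ p j≤j′ , inject≤ a t≤t′

  embedKV-injective : Injective _≡_ _≡_ embedKV
  embedKV-injective eq = let (p≡q , a≡b) = ,-injective eq in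
    cong₂ _,_ (inject≤-injective j≤j′ j≤j′ _ _ p≡q) (inject≤-injective t≤t′ t≤t′ _ _ a≡b)

  restrict : ∀ {k} → Colouring k j′ t′ → Colouring k j t
  restrict c = record
    { colour = λ u v → colour c (embedKV u) (embedKV v)
    ; sym    = λ u v → Colouring.sym c (embedKV u) (embedKV v)
    }

  copy-restrict : ∀ {k ℓ H} {c : Colouring k j′ t′} → ContainsCopy (restrict c) ℓ H → ContainsCopy c ℓ H
  copy-restrict (f , f-injective , f-edge) =
    embedKV ∘ f , f-injective ∘ embedKV-injective ,
    λ u v uv → let (fu≁fv , colour≡) = f-edge u v uv in
               fu≁fv ∘ inject≤-injective j≤j′ j≤j′ _ _ , colour≡

  Arrows-mono : ∀ {k} {Hs : Fin k → Graph} → Arrows j t Hs → Arrows j′ t′ Hs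
  Arrows-mono arrows c = Prod.map₂ (copy-restrict {c = c}) (arrows (restrict c))

-- Lower bounds

triangle≢matchingColour : ∀ {i} (col : Fin 2) (ℓ : Fin i) → col ↑ˡ i ≢ suc (suc ℓ)
triangle≢matchingColour zero ℓ ()
triangle≢matchingColour (suc zero) ℓ ()

module _ {i j t} (ns : Vec ℕ i) (c : Colouring (2 + i) j t) where

  noTriTriMatchingCopy : (φ : KV j t → Fin 5) →
    (∀ col {u v} → Edge c (col ↑ˡ i) u v → ColourClass pentagon col (φ u) (φ v)) →
    (∀ ℓ → ∃ λ m → m < lookup ns ℓ × Cover c (suc (suc ℓ)) m) →
    ¬ ∃ λ ℓ → ContainsCopy c ℓ (triTriMatchings ns ℓ)
  noTriTriMatchingCopy φ toPentagon covers (zero , copy) =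
    triangleFree⇒noCopy c φ (toPentagon zero) (pentagon-triangleFree zero) copy
  noTriTriMatchingCopy φ toPentagon covers (suc zero , copy) =
    triangleFree⇒noCopy c φ (toPentagon (suc zero)) (pentagon-triangleFree (suc zero)) copy
  noTriTriMatchingCopy φ toPentagon covers (suc (suc ℓ) , copy) =
    let (_ , m<n , cover) = covers ℓ in cover⇒noMatching c m<n cover copy

pentagonColouring : ∀ {i t} → Colouring (2 + i) 5 t
pentagonColouring {i} = record
  { colour = λ u v → pentagon (part u) (part v) ↑ˡ i
  ; sym    = λ u v → cong (_↑ˡ i) (pentagon-sym (part u) (part v))
  }

¬Arrows-pentagon : ∀ {i} (ns : Vec ℕ i) → All (1 ≤_) ns → ∀ t → ¬ Arrows 5 t (triTriMatchings ns)
¬Arrows-pentagon {i} ns positive t arrows =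
  noTriTriMatchingCopy ns pentagonColouring part toPentagon noEdges (arrows pentagonColouring)
  where
  toPentagon : ∀ col {u v} → Edge pentagonColouring (col ↑ˡ i) u v →
    ColourClass pentagon col (part u) (part v)
  toPentagon col (u≁v , colour≡) = u≁v , ↑ˡ-injective i _ _ colour≡
  noEdges : ∀ ℓ → ∃ λ m → m < lookup ns ℓ × Cover pentagonColouring (suc (suc ℓ)) m
  noEdges ℓ = 0 , lookup⁺ positive ℓ , (λ ()) ,
    λ {u} {v} (_ , colour≡) → contradiction colour≡ (triangle≢matchingColour (pentagon (part u) (part v)) ℓ)

module BlockColouring {i} (f : Fin i → ℕ) where

  block : Fin (∑ f) → Fin i
  block = proj₁ ∘ splitΣ f

  inBlock : ∀ {ℓ} a → block a ≡ ℓ → ∃ λ x → combineΣ f (ℓ , x) ≡ a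
  inBlock a refl = proj₂ (splitΣ f a) , combineΣ-splitΣ f a

  -- Parts 0–4 (inj₁) carry the pentagon colouring; an edge at vertex a of the sixth
  -- part (inj₂) gets the matching colour of the block of a.
  blockColour : (Fin 5 ⊎ Fin 1) × Fin (∑ f) → (Fin 5 ⊎ Fin 1) × Fin (∑ f) → Fin (2 + i)
  blockColour (inj₁ x , _) (inj₁ y , _) = pentagon x y ↑ˡ i
  blockColour (inj₁ _ , _) (inj₂ _ , b) = suc (suc (block b))
  blockColour (inj₂ _ , a) (inj₁ _ , _) = suc (suc (block a))
  blockColour (inj₂ _ , _) (inj₂ _ , _) = zero

  blockColour-sym : ∀ u v → blockColour u v ≡ blockColour v u
  blockColour-sym (inj₁ x , _) (inj₁ y , _) = cong (_↑ˡ i) (pentagon-sym x y)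
  blockColour-sym (inj₁ _ , _) (inj₂ _ , _) = refl
  blockColour-sym (inj₂ _ , _) (inj₁ _ , _) = refl
  blockColour-sym (inj₂ _ , _) (inj₂ _ , _) = refl

  view : KV 6 (∑ f) → (Fin 5 ⊎ Fin 1) × Fin (∑ f)
  view (p , a) = splitAt 5 p , a

  colouring : Colouring (2 + i) 6 (∑ f)
  colouring = record
    { colour = λ u v → blockColour (view u) (view v)
    ; sym    = λ u v → blockColour-sym (view u) (view v)
    }

  -- The sixth part is sent to an arbitrary vertex: no edge of colour 0 or 1 meets it.
  pentagonVertex : KV 6 (∑ f) → Fin 5
  pentagonVertex (p , _) = [ id , const zero ]′ (splitAt 5 p)

  toPentagon : ∀ col {u v} → Edge colouring (col ↑ˡ i) u v →
    ColourClass pentagon col (pentagonVertex u) (pentagonVertex v)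
  toPentagon col {p , _} {q , _} (p≢q , colour≡) with splitAt 5 p in ep | splitAt 5 q in eq
  ... | inj₁ x | inj₁ y = (λ x≡y → p≢q (splitAt-injective 5 (trans ep (trans (cong inj₁ x≡y) (sym eq))))) ,
                          ↑ˡ-injective i _ _ colour≡
  ... | inj₁ _ | inj₂ _ = contradiction (sym colour≡) (triangle≢matchingColour col _)
  ... | inj₂ _ | inj₁ _ = contradiction (sym colour≡) (triangle≢matchingColour col _)
  ... | inj₂ zero | inj₂ zero = contradiction (splitAt-injective 5 (trans ep (sym eq))) p≢q

  blockCover : ∀ ℓ → Cover colouring (suc (suc ℓ)) (f ℓ)
  blockCover ℓ = (λ x → fromℕ 5 , combineΣ f (ℓ , x)) , covers
    where
    covers : ∀ {u v} → Edge colouring (suc (suc ℓ)) u v →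
      ∃ λ x → (fromℕ 5 , combineΣ f (ℓ , x)) ≡ u ⊎ (fromℕ 5 , combineΣ f (ℓ , x)) ≡ v
    covers {p , a} {q , b} (p≢q , colour≡) with splitAt 5 p in ep | splitAt 5 q in eq
    ... | inj₁ x | inj₁ y = contradiction colour≡ (triangle≢matchingColour (pentagon x y) ℓ)
    ... | inj₁ _ | inj₂ zero =
      let (x , b≡) = inBlock b (suc-injective (suc-injective colour≡)) in
      x , inj₂ (cong₂ _,_ (splitAt⁻¹-↑ʳ eq) b≡)
    ... | inj₂ zero | inj₁ _ =
      let (x , a≡) = inBlock a (suc-injective (suc-injective colour≡)) in
      x , inj₁ (cong₂ _,_ (splitAt⁻¹-↑ʳ ep) a≡)
    ... | inj₂ zero | inj₂ zero = contradiction (splitAt-injective 5 (trans ep (sym eq))) p≢q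

budget : ∀ {i} → Vec ℕ i → ℕ
budget ns = ∑ (λ ℓ → lookup ns ℓ ∸ 1)

matchingBound≡suc-budget : ∀ {i} (ns : Vec ℕ i) → matchingBound ns ≡ suc (budget ns)
matchingBound≡suc-budget ns = cong suc (sum-map (λ n → n ∸ 1) ns)

¬Arrows-blocks : ∀ {i} (ns : Vec ℕ i) → All (1 ≤_) ns → ¬ Arrows 6 (budget ns) (triTriMatchings ns)
¬Arrows-blocks ns positive arrows =
  noTriTriMatchingCopy ns colouring pentagonVertex toPentagon
    (λ ℓ → _ , pred< (lookup⁺ positive ℓ) , blockCover ℓ) (arrows colouring)
  where
  open BlockColouring (λ ℓ → lookup ns ℓ ∸ 1)
  pred< : ∀ {n} → 1 ≤ n → n ∸ 1 < n
  pred< (s≤s _) = n<1+n _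

-- Upper bound

IsMatchingColour : ∀ {i} → Fin (2 + i) → Set
IsMatchingColour {i} w = ∃ λ (ℓ : Fin i) → w ≡ suc (suc ℓ)

isMatchingColour? : ∀ {i} (w : Fin (2 + i)) → Dec (IsMatchingColour w)
isMatchingColour? zero = no λ ()
isMatchingColour? (suc zero) = no λ ()
isMatchingColour? (suc (suc ℓ)) = yes (ℓ , refl)

-- Junk value 0 on the matching colours.
triangleColour : ∀ {i} → Fin (2 + i) → Fin 2
triangleColour zero = zero
triangleColour (suc zero) = suc zero
triangleColour (suc (suc _)) = zero

triangleColour-↑ˡ : ∀ {i} (w : Fin (2 + i)) → ¬ IsMatchingColour w → triangleColour w ↑ˡ i ≡ w
triangleColour-↑ˡ zero _ = refl
triangleColour-↑ˡ (suc zero) _ = refl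
triangleColour-↑ˡ (suc (suc ℓ)) notMatching = contradiction (ℓ , refl) notMatching

module Greedy {i t} (ns : Vec ℕ i) (positive : All (1 ≤_) ns) (c : Colouring (2 + i) 6 t)
  (room : budget ns < t) where

  Result : Set
  Result = ∃ λ ℓ → ContainsCopy c ℓ (triTriMatchings ns ℓ)

  triangleResult : ∀ col → ContainsCopy c (col ↑ˡ i) C₃ → Result
  triangleResult zero copy = zero , copy
  triangleResult (suc zero) copy = suc zero , copy

  Partial : Fin i → Set
  Partial ℓ = ∃ λ m → m < lookup ns ℓ × ContainsCopy c (suc (suc ℓ)) (matching m)

  State : Set
  State = ∀ ℓ → Partial ℓ

  size : State → Fin i → ℕ
  size s = proj₁ ∘ s

  size-bound : ∀ s → ∑ (size s) ≤ budget ns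
  size-bound s = ∑-mono-≤ λ ℓ → ≤∸1 (proj₁ (proj₂ (s ℓ)))
    where
    ≤∸1 : ∀ {m n} → m < n → m ≤ n ∸ 1
    ≤∸1 (s≤s m≤n) = m≤n

  Outcome : State → Set
  Outcome s = Result ⊎ Σ State (λ s′ → ∑ (size s′) ≡ suc (∑ (size s)))

  update : State → ∀ ℓ → Partial ℓ → State
  update s ℓ new ℓ′ with ℓ′ ≟ ℓ
  ... | yes refl = new
  ... | no _ = s ℓ′

  update-here : ∀ s ℓ new → update s ℓ new ℓ ≡ new
  update-here s ℓ new with ℓ ≟ ℓ
  ... | yes refl = refl
  ... | no ℓ≢ℓ = contradiction refl ℓ≢ℓ

  update-there : ∀ s ℓ new {ℓ′} → ℓ′ ≢ ℓ → update s ℓ new ℓ′ ≡ s ℓ′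
  update-there s ℓ new {ℓ′} ℓ′≢ℓ with ℓ′ ≟ ℓ
  ... | yes ℓ′≡ℓ = contradiction ℓ′≡ℓ ℓ′≢ℓ
  ... | no _ = refl

  module _ (s : State) where

    copy : ∀ ℓ → ContainsCopy c (suc (suc ℓ)) (matching (size s ℓ))
    copy ℓ = proj₂ (proj₂ (s ℓ))

    M : ∀ ℓ → Fin (size s ℓ) × Fin 2 → KV 6 t
    M ℓ = proj₁ (copy ℓ)

    free : ∀ p → ∃ λ a → ∀ ℓ → Avoids (M ℓ) (p , a)
    free = freeVertex (size s) M crossing (≤-<-trans (size-bound s) room)
      where
      crossing : ∀ ℓ e → KAdj (M ℓ (e , zero)) (M ℓ (e , suc zero))
      crossing ℓ e = proj₁ (proj₂ (proj₂ (copy ℓ)) (e , zero) (e , suc zero) (refl , λ ()))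

    x : Fin 6 → KV 6 t
    x p = p , proj₁ (free p)

    MatchingEdge : Set
    MatchingEdge = ∃ λ p → ∃ λ q → p ≢ q × IsMatchingColour (colour c (x p) (x q))

    grow : ∀ ℓ → size s ℓ < lookup ns ℓ → ContainsCopy c (suc (suc ℓ)) (matching (suc (size s ℓ))) →
      Outcome s
    grow ℓ m<n bigger with suc (size s ℓ) <? lookup ns ℓ
    ... | yes room′ = inj₂ (update s ℓ (_ , room′ , bigger) ,
      ∑-suc-at ℓ (cong proj₁ (update-here s ℓ _)) λ ℓ′ ℓ′≢ℓ → cong proj₁ (update-there s ℓ _ ℓ′≢ℓ))
    ... | no full = inj₁ (suc (suc ℓ) ,
      subst (ContainsCopy c _ ∘ matching) (≤-antisym m<n (≮⇒≥ full)) bigger)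

    extend : MatchingEdge → Outcome s
    extend (p , q , p≢q , ℓ , colour≡) = grow ℓ (proj₁ (proj₂ (s ℓ)))
      (extendMatching c (copy ℓ) (p≢q , colour≡) (proj₂ (free p) ℓ) (proj₂ (free q) ℓ))

    triangle : ¬ MatchingEdge → Result
    triangle noMatchingEdge = let (col , tri) = ramsey33 κ in triangleResult col (triangle⇒copy c x edge tri)
      where
      κ : Fin 6 → Fin 6 → Fin 2
      κ p q = triangleColour (colour c (x p) (x q))
      edge : ∀ {col p q} → ColourClass κ col p q → Edge c (col ↑ˡ i) (x p) (x q)
      edge {col} {p} {q} (p≢q , κ≡col) = p≢q , (begin
        colour c (x p) (x q)   ≡⟨ triangleColour-↑ˡ _ (λ isMatching → noMatchingEdge (p , q , p≢q , isMatching)) ⟨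
        κ p q ↑ˡ i             ≡⟨ cong (_↑ˡ i) κ≡col ⟩
        col ↑ˡ i               ∎)
        where open ≡-Reasoning

    -- Opaque, so that the with-abstraction in step does not unfold the search over all pairs.
    opaque
      matchingEdge? : Dec MatchingEdge
      matchingEdge? = any? λ p → any? λ q → ¬? (p ≟ q) ×-dec isMatchingColour? (colour c (x p) (x q))

    step : Outcome s
    step with matchingEdge?
    ... | yes matchingEdge = extend matchingEdge
    ... | no noMatchingEdge = inj₁ (triangle noMatchingEdge)

  greedy : ∀ fuel (s : State) → budget ns ≤ ∑ (size s) + fuel → Result
  greedy fuel s enough with step s
  ... | inj₁ done = done
  greedy zero s enough | inj₂ (s′ , grown) = contradiction (begin-strict
    ∑ (size s)          <⟨ n<1+n _ ⟩
    suc (∑ (size s))    ≡⟨ grown ⟨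
    ∑ (size s′)         ≤⟨ size-bound s′ ⟩
    budget ns           ≤⟨ enough ⟩
    ∑ (size s) + 0      ≡⟨ +-identityʳ _ ⟩
    ∑ (size s)          ∎) (<-irrefl refl)
    where open ≤-Reasoning
  greedy (suc fuel) s enough | inj₂ (s′ , grown) =
    greedy fuel s′ (subst (budget ns ≤_) (trans (+-suc _ fuel) (cong (_+ fuel) (sym grown))) enough)

  result : Result
  result = greedy (budget ns) (λ ℓ → 0 , lookup⁺ positive ℓ , emptyMatching c) (m≤n+m _ _)

Arrows-upper : ∀ {i} (ns : Vec ℕ i) → All (1 ≤_) ns → Arrows 6 (matchingBound ns) (triTriMatchings ns)
Arrows-upper ns positive c =
  Greedy.result ns positive c (≤-reflexive (sym (matchingBound≡suc-budget ns)))

theorem1 : (i : ℕ) (ns : Vec ℕ i) (j : ℕ) → 1 ≤ i → All (1 ≤_) ns → 1 ≤ j → j ≤ 6 →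
    (j ≤ 5 → MultipartiteRamsey j (triTriMatchings ns) ∞) ×
    (j ≡ 6 → MultipartiteRamsey j (triTriMatchings ns) (fin (matchingBound ns)))
theorem1 i ns j _ positive _ _ = infinite , finite
  where
  infinite : j ≤ 5 → MultipartiteRamsey j (triTriMatchings ns) ∞
  infinite j≤5 t _ = ¬Arrows-pentagon ns positive t ∘ Arrows-mono j≤5 ≤-refl
  finite : j ≡ 6 → MultipartiteRamsey j (triTriMatchings ns) (fin (matchingBound ns))
  finite refl = s≤s z≤n , Arrows-upper ns positive ,
    λ t _ t<bound → ¬Arrows-blocks ns positive ∘
      Arrows-mono ≤-refl (≤-pred (subst (t <_) (matchingBound≡suc-budget ns) t<bound))
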